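{- For every integer $n\ge 1$, $R_n(P_n)=\frac{1}{3}\left(2^{n+1}+(-1)^n\right)$ and $R_{n-1}(P_n)=\frac{1}{3}\left(2^{n}+(-1)^{n+1}\right)$.
   Context: All matrices are over $\mathbb{F}_2$. $P_n$ is the path graph with vertices $x_1,\dots,x_n$ and edges $x_ix_{i+1}$. A symmetric matrix $M\in M_n(\mathbb{F}_2)$ represents a graph (with respect to a vertex ordering) if for $i\ne j$ its $(i,j)$-entry is $1$ exactly when the $i$-th and $j$-th vertices are adjacent and $0$ otherwise, the diagonal being arbitrary. $R_k(\Gamma)$ is the number of such matrices representing $\Gamma$ that have rank $k$. (For $P_n$ in the given ordering, these are exactly the tridiagonal matrices with all sub- and superdiagonal entries equal to $1$ and arbitrary diagonal.) -}

module Defs where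

open import Data.Bool using (Bool; true; false; _∧_; _∨_; _xor_; not; if_then_else_)
open import Data.Nat using (ℕ; zero; suc; _+_; _⊔_; _≡ᵇ_)
open import Data.Fin using (Fin; toℕ)
open import Data.List using (List; []; _∷_; map; _++_; foldr; filter; length; concatMap)
open import Data.Vec using (Vec; []; _∷_; tabulate; lookup; replicate; zipWith)
open import Relation.Nullary.Decidable using (does)
open import Relation.Binary.PropositionalEquality using (_≡_)

-- The field F₂ is modelled by Bool: addition = xor, multiplication = ∧.
F₂ : Set
F₂ = Bool

Vec₂ : ℕ → Set
Vec₂ n = Vec F₂ n

Mat : ℕ → ℕ → Set
Mat m n = Vec (Vec₂ n) m

allVecs : (n : ℕ) → List (Vec₂ n)
allVecs zero = [] ∷ []
allVecs (suc n) = map (false ∷_) (allVecs n) ++ map (true ∷_) (allVecs n)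

zeroVec : (n : ℕ) → Vec₂ n
zeroVec n = replicate n false

_+ᵥ_ : {n : ℕ} → Vec₂ n → Vec₂ n → Vec₂ n
u +ᵥ v = zipWith _xor_ u v

isZero : {n : ℕ} → Vec₂ n → Bool
isZero [] = true
isZero (x ∷ v) = not x ∧ isZero v

combo : {m n : ℕ} → Vec₂ m → Mat m n → Vec₂ n
combo {n = n} [] [] = zeroVec n
combo (c ∷ cs) (r ∷ rs) = if c then r +ᵥ combo cs rs else combo cs rs

-- Subsets of row indices are represented by characteristic vectors.
_⊆ᵇ_ : {m : ℕ} → Vec₂ m → Vec₂ m → Bool
[] ⊆ᵇ [] = true
(a ∷ as) ⊆ᵇ (b ∷ bs) = (not a ∨ b) ∧ (as ⊆ᵇ bs)

size : {m : ℕ} → Vec₂ m → ℕ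
size [] = 0
size (true ∷ v) = suc (size v)
size (false ∷ v) = size v

allᵇ : {A : Set} → (A → Bool) → List A → Bool
allᵇ p = foldr (λ x b → p x ∧ b) true

independentRows : {m n : ℕ} → Mat m n → Vec₂ m → Bool
independentRows {m} M S =
  allᵇ (λ T → not (T ⊆ᵇ S) ∨ isZero T ∨ not (isZero (combo T M))) (allVecs m)

rank : {m n : ℕ} → Mat m n → ℕ
rank {m} M =
  foldr (λ S r → (if independentRows M S then size S else 0) ⊔ r) 0 (allVecs m)

adjPath : {n : ℕ} → Fin n → Fin n → Bool
adjPath i j = (suc (toℕ i) ≡ᵇ toℕ j) ∨ (suc (toℕ j) ≡ᵇ toℕ i)

pathMatrix : {n : ℕ} → Vec₂ n → Mat n n
pathMatrix d = tabulate (λ i → tabulate (λ j →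
  if toℕ i ≡ᵇ toℕ j then lookup d i else (if adjPath i j then true else false)))

countᵇ : {A : Set} → (A → Bool) → List A → ℕ
countᵇ p = foldr (λ x c → if p x then suc c else c) 0

-- R_k(P_n): the number of matrices representing P_n (one for each choice of
-- diagonal d ∈ F₂ⁿ) whose rank over F₂ is k.
R-path : (k n : ℕ) → ℕ
R-path k n = countᵇ (λ d → rank (pathMatrix d) ≡ᵇ k) (allVecs n)

-- Reading the columns of the tridiagonal matrix M_d with diagonal d one at a time, a
-- combination (t₁, …, tₙ) of its rows vanishes iff, with t₀ = 0, t_{i+1} = t_{i−1} + dᵢ tᵢ
-- and t_{n+1} = 0.  Such a t is determined by t₁, so M_d has rank n when the continuant
-- K(d) = t_{n+1}|_{t₁=1} is 1 and rank n − 1 otherwise (rows 2, …, n are always independent).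
-- Splitting off the first two diagonal entries, the number c(n) of diagonals with a given
-- value of K(d) satisfies c(n+2) = c(n+1) + 2 c(n), whose solutions are combinations of 2ⁿ
-- and (−1)ⁿ.
module Submission where

open import Defs
open import Data.Nat using (ℕ; _≤_; _^_; _*_; _+_; _∸_)
open import Data.Integer using (ℤ; +_; -1ℤ) renaming (_+_ to _+ℤ_; _^_ to _^ℤ_)
open import Data.Product using (_×_)
open import Relation.Binary.PropositionalEquality using (_≡_)

open import Data.Bool using (Bool; true; false; _∧_; _∨_; _xor_; not; if_then_else_)
open import Data.Bool.Properties using (∨-zeroʳ; not-injective)
open import Data.Empty using (⊥; ⊥-elim)
open import Data.Fin using (Fin; toℕ)
import Data.Fin as Fin
open import Data.Integer using () renaming (_*_ to _*ℤ_)
import Data.Integer.Properties as ℤ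
open import Data.Integer.Tactic.RingSolver using (solve-∀)
open import Data.List using (List; []; _∷_; _++_; map; foldr)
open import Data.List.Membership.Propositional using (_∈_)
open import Data.List.Membership.Propositional.Properties using (∈-map⁺; ∈-++⁺ˡ; ∈-++⁺ʳ)
open import Data.List.Relation.Unary.Any using (here; there)
open import Data.Nat using (zero; suc; _⊔_; _≡ᵇ_; _≟_; z≤n; s≤s)
import Data.Nat.Properties as ℕ
import Data.Nat.Tactic.RingSolver as ℕ-Solver
open import Data.Product using (Σ-syntax; _,_; proj₁)
open import Data.Vec using (Vec; []; _∷_; replicate; tabulate; lookup; tail)
open import Function using (id)
open import Relation.Binary.PropositionalEquality using (refl; sym; trans; ≢-sym; cong; cong₂; subst; module ≡-Reasoning)
open import Relation.Nullary.Decidable using (dec-true; dec-false)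

private
  variable
    A : Set
    m n : ℕ

∈-allVecs : (v : Vec₂ n) → v ∈ allVecs n
∈-allVecs [] = here refl
∈-allVecs {suc n} (false ∷ v) = ∈-++⁺ˡ (∈-map⁺ (false ∷_) (∈-allVecs v))
∈-allVecs {suc n} (true ∷ v) = ∈-++⁺ʳ (map (false ∷_) (allVecs n)) (∈-map⁺ (true ∷_) (∈-allVecs v))

allᵇ-true : (p : A → Bool) (xs : List A) → (∀ x → p x ≡ true) → allᵇ p xs ≡ true
allᵇ-true p [] h = refl
allᵇ-true p (x ∷ xs) h rewrite h x = allᵇ-true p xs h

allᵇ-false : (p : A → Bool) {x : A} (xs : List A) → x ∈ xs → p x ≡ false → allᵇ p xs ≡ false
allᵇ-false p (y ∷ xs) (here refl) h rewrite h = refl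
allᵇ-false p (y ∷ xs) (there x∈xs) h rewrite allᵇ-false p xs x∈xs h with p y
... | true = refl
... | false = refl

foldr-⊔-lub : (f : A → ℕ) {k : ℕ} (xs : List A) → (∀ x → f x ≤ k) → foldr (λ x r → f x ⊔ r) 0 xs ≤ k
foldr-⊔-lub f [] h = z≤n
foldr-⊔-lub f (x ∷ xs) h = ℕ.⊔-lub (h x) (foldr-⊔-lub f xs h)

foldr-⊔-upper : (f : A → ℕ) {x : A} (xs : List A) → x ∈ xs → f x ≤ foldr (λ y r → f y ⊔ r) 0 xs
foldr-⊔-upper f (y ∷ xs) (here refl) = ℕ.m≤m⊔n (f y) _
foldr-⊔-upper f (y ∷ xs) (there x∈xs) = ℕ.≤-trans (foldr-⊔-upper f xs x∈xs) (ℕ.m≤n⊔m (f y) _)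

countᵇ-++ : (p : A → Bool) (xs ys : List A) → countᵇ p (xs ++ ys) ≡ countᵇ p xs + countᵇ p ys
countᵇ-++ p [] ys = refl
countᵇ-++ p (x ∷ xs) ys with p x
... | true = cong suc (countᵇ-++ p xs ys)
... | false = countᵇ-++ p xs ys

countᵇ-map : {B : Set} (p : B → Bool) (f : A → B) (xs : List A) →
  countᵇ p (map f xs) ≡ countᵇ (λ x → p (f x)) xs
countᵇ-map p f [] = refl
countᵇ-map p f (x ∷ xs) with p (f x)
... | true = cong suc (countᵇ-map p f xs)
... | false = countᵇ-map p f xs

countᵇ-cong : {p q : A → Bool} (xs : List A) → (∀ x → p x ≡ q x) → countᵇ p xs ≡ countᵇ q xs
countᵇ-cong [] h = refl
countᵇ-cong {q = q} (x ∷ xs) h rewrite h x with q x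
... | true = cong suc (countᵇ-cong xs h)
... | false = countᵇ-cong xs h

countᵇ-allVecs-suc : (p : Vec₂ (suc n) → Bool) →
  countᵇ p (allVecs (suc n)) ≡ countᵇ (λ d → p (false ∷ d)) (allVecs n) + countᵇ (λ d → p (true ∷ d)) (allVecs n)
countᵇ-allVecs-suc {n} p
  rewrite countᵇ-++ p (map (false ∷_) (allVecs n)) (map (true ∷_) (allVecs n))
        | countᵇ-map p (false ∷_) (allVecs n)
        | countᵇ-map p (true ∷_) (allVecs n) = refl

size≤ : (S : Vec₂ n) → size S ≤ n
size≤ [] = z≤n
size≤ (true ∷ S) = s≤s (size≤ S)
size≤ (false ∷ S) = ℕ.m≤n⇒m≤1+n (size≤ S)

size-replicate-true : (n : ℕ) → size (replicate n true) ≡ n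
size-replicate-true zero = refl
size-replicate-true (suc n) = cong suc (size-replicate-true n)

size≡n⇒replicate-true : (S : Vec₂ n) → size S ≡ n → S ≡ replicate n true
size≡n⇒replicate-true [] _ = refl
size≡n⇒replicate-true (true ∷ S) eq = cong (true ∷_) (size≡n⇒replicate-true S (ℕ.suc-injective eq))
size≡n⇒replicate-true (false ∷ S) eq = ⊥-elim (ℕ.<⇒≱ (s≤s (size≤ S)) (ℕ.≤-reflexive (sym eq)))

⊆ᵇ-replicate-true : (T : Vec₂ n) → (T ⊆ᵇ replicate n true) ≡ true
⊆ᵇ-replicate-true [] = refl
⊆ᵇ-replicate-true (true ∷ T) = ⊆ᵇ-replicate-true T
⊆ᵇ-replicate-true (false ∷ T) = ⊆ᵇ-replicate-true T

module _ {m n : ℕ} (M : Mat m n) where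

  independentRows-intro : (S : Vec₂ m) →
    (∀ T → T ⊆ᵇ S ≡ true → isZero (combo T M) ≡ true → isZero T ≡ true) →
    independentRows M S ≡ true
  independentRows-intro S h = allᵇ-true _ (allVecs m) clause
    where
    clause : ∀ T → (not (T ⊆ᵇ S) ∨ isZero T ∨ not (isZero (combo T M))) ≡ true
    clause T with T ⊆ᵇ S in T⊆S | isZero (combo T M) in zero-combo
    ... | false | _ = refl
    ... | true | false = ∨-zeroʳ (isZero T)
    ... | true | true rewrite h T T⊆S zero-combo = refl

  dependentRows : (S T : Vec₂ m) → T ⊆ᵇ S ≡ true → isZero T ≡ false → isZero (combo T M) ≡ true →
    independentRows M S ≡ false
  dependentRows S T T⊆S nonzero zero-combo = allᵇ-false _ (allVecs m) (∈-allVecs T) clause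
    where
    clause : (not (T ⊆ᵇ S) ∨ isZero T ∨ not (isZero (combo T M))) ≡ false
    clause rewrite T⊆S | nonzero | zero-combo = refl

  size≤rank : (S : Vec₂ m) → independentRows M S ≡ true → size S ≤ rank M
  size≤rank S indep = subst (_≤ rank M) value (foldr-⊔-upper _ (allVecs m) (∈-allVecs S))
    where
    value : (if independentRows M S then size S else 0) ≡ size S
    value rewrite indep = refl

  rank≤ : (k : ℕ) → (∀ S → independentRows M S ≡ true → size S ≤ k) → rank M ≤ k
  rank≤ k h = foldr-⊔-lub _ (allVecs m) bound
    where
    bound : ∀ S → (if independentRows M S then size S else 0) ≤ k
    bound S with independentRows M S in indep
    ... | true = h S indep
    ... | false = z≤n

rank-full : (M : Mat m n) → independentRows M (replicate m true) ≡ true → rank M ≡ m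
rank-full {m} M indep = ℕ.≤-antisym
  (rank≤ M m (λ S _ → size≤ S))
  (subst (_≤ rank M) (size-replicate-true m) (size≤rank M _ indep))

rank-corank₁ : (M : Mat (suc m) n) →
  independentRows M (false ∷ replicate m true) ≡ true → independentRows M (replicate (suc m) true) ≡ false →
  rank M ≡ m
rank-corank₁ {m} M indep dep = ℕ.≤-antisym
  (rank≤ M m λ S indepS → ℕ.≤-pred (ℕ.≤∧≢⇒< (size≤ S) (not-all S indepS)))
  (subst (_≤ rank M) (size-replicate-true m) (size≤rank M _ indep))
  where
  not-all : ∀ S → independentRows M S ≡ true → size S ≡ suc m → ⊥
  not-all S indepS full with size≡n⇒replicate-true S full
  ... | refl with trans (sym indepS) dep
  ... | ()

dot : Vec₂ n → (Fin n → Bool) → Bool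
dot [] c = false
dot (t₀ ∷ t) c = (t₀ ∧ c Fin.zero) xor dot t (λ i → c (Fin.suc i))

dot-const-false : (t : Vec₂ n) → dot t (λ _ → false) ≡ false
dot-const-false [] = refl
dot-const-false (true ∷ t) = dot-const-false t
dot-const-false (false ∷ t) = dot-const-false t

combo-tabulate-∷ : (t : Vec₂ m) (c : Fin m → Bool) (g : Fin m → Vec₂ n) →
  combo t (tabulate (λ i → c i ∷ g i)) ≡ dot t c ∷ combo t (tabulate g)
combo-tabulate-∷ [] c g = refl
combo-tabulate-∷ (true ∷ t) c g rewrite combo-tabulate-∷ t (λ i → c (Fin.suc i)) (λ i → g (Fin.suc i)) = refl
combo-tabulate-∷ (false ∷ t) c g = combo-tabulate-∷ t (λ i → c (Fin.suc i)) (λ i → g (Fin.suc i))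

headOrFalse : Vec₂ n → Bool
headOrFalse [] = false
headOrFalse (x ∷ _) = x

addToHead : Bool → Vec₂ n → Vec₂ n
addToHead b [] = []
addToHead b (x ∷ v) = (b xor x) ∷ v

addToHead-false : (v : Vec₂ n) → addToHead false v ≡ v
addToHead-false [] = refl
addToHead-false (x ∷ v) = refl

dot-firstColumn : (t : Vec₂ n) → dot t (λ i → if 0 ≡ᵇ toℕ i then true else false) ≡ headOrFalse t
dot-firstColumn [] = refl
dot-firstColumn (true ∷ t) = cong not (dot-const-false t)
dot-firstColumn (false ∷ t) = dot-const-false t

firstUnit-+ᵥ : (v : Vec₂ n) → tabulate (λ j → if (0 ≡ᵇ toℕ j) ∨ false then true else false) +ᵥ v ≡ addToHead true v
firstUnit-+ᵥ [] = refl
firstUnit-+ᵥ (x ∷ v) = cong (not x ∷_) (zero-+ᵥ v)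
  where
  zero-+ᵥ : (w : Vec₂ m) → tabulate (λ _ → false) +ᵥ w ≡ w
  zero-+ᵥ [] = refl
  zero-+ᵥ (y ∷ w) = cong (y ∷_) (zero-+ᵥ w)

combo-lowerRows : (d₀ : Bool) (d t : Vec₂ n) →
  combo t (tail (pathMatrix (d₀ ∷ d))) ≡ headOrFalse t ∷ combo t (pathMatrix d)
combo-lowerRows {n} d₀ d t = trans (combo-tabulate-∷ t firstColumn row) (cong (_∷ combo t (pathMatrix d)) (dot-firstColumn t))
  where
  -- pathMatrix (d₀ ∷ d) unfolds to a first row followed by firstColumn i ∷ row i, and pathMatrix d to tabulate row.
  firstColumn : Fin n → Bool
  firstColumn i = if 0 ≡ᵇ toℕ i then true else false
  row : Fin n → Vec₂ n
  row i = tabulate (λ j → if toℕ i ≡ᵇ toℕ j then lookup d i else (if adjPath i j then true else false))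

combo-pathMatrix-∷ : (d₀ t₀ : Bool) (d t : Vec₂ n) →
  combo (t₀ ∷ t) (pathMatrix (d₀ ∷ d)) ≡ ((t₀ ∧ d₀) xor headOrFalse t) ∷ addToHead t₀ (combo t (pathMatrix d))
combo-pathMatrix-∷ d₀ true d t rewrite combo-lowerRows d₀ d t = cong (_ ∷_) (firstUnit-+ᵥ _)
combo-pathMatrix-∷ d₀ false d t rewrite combo-lowerRows d₀ d t = cong (_ ∷_) (sym (addToHead-false _))

-- a e₁ + t · pathMatrix d = 0, where the carry a is the coefficient of the row above in a longer path.
isZeroWithCarry : Vec₂ n → Bool → Vec₂ n → Bool
isZeroWithCarry d a t = isZero (addToHead a (combo t (pathMatrix d)))

isZeroWithCarry-∷ : (d₀ a t₀ : Bool) (d t : Vec₂ n) →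
  isZeroWithCarry (d₀ ∷ d) a (t₀ ∷ t) ≡ not (a xor ((t₀ ∧ d₀) xor headOrFalse t)) ∧ isZeroWithCarry d t₀ t
isZeroWithCarry-∷ d₀ a t₀ d t rewrite combo-pathMatrix-∷ d₀ t₀ d t = refl

isZero-combo-pathMatrix : (d t : Vec₂ n) → isZero (combo t (pathMatrix d)) ≡ isZeroWithCarry d false t
isZero-combo-pathMatrix d t = cong isZero (sym (addToHead-false (combo t (pathMatrix d))))

-- The last term t_{n+1} of t₀ = a, t₁ = y, t_{i+1} = t_{i−1} + dᵢ tᵢ; for (a, y) = (0, 1) it is
-- the continuant of d, i.e. det (pathMatrix d).
continuant : Vec₂ n → Bool → Bool → Bool
continuant [] a y = y
continuant (d₀ ∷ d) a y = continuant d y (a xor (y ∧ d₀))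

not-xor-xor≡true⇒≡xor : ∀ a b c → not (a xor (b xor c)) ≡ true → c ≡ a xor b
not-xor-xor≡true⇒≡xor true true true ()
not-xor-xor≡true⇒≡xor true true false _ = refl
not-xor-xor≡true⇒≡xor true false true _ = refl
not-xor-xor≡true⇒≡xor true false false ()
not-xor-xor≡true⇒≡xor false true true _ = refl
not-xor-xor≡true⇒≡xor false true false ()
not-xor-xor≡true⇒≡xor false false true ()
not-xor-xor≡true⇒≡xor false false false _ = refl

not-xor-xor-cancel : ∀ a b → not (a xor (b xor (a xor b))) ≡ true
not-xor-xor-cancel true true = refl
not-xor-xor-cancel true false = refl
not-xor-xor-cancel false true = refl
not-xor-xor-cancel false false = refl

∧-≡true : ∀ {a b} → a ∧ b ≡ true → a ≡ true × b ≡ true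
∧-≡true {true} {true} refl = refl , refl

isZeroWithCarry⇒isZero : (d t : Vec₂ n) → isZeroWithCarry d false t ≡ true → headOrFalse t ≡ false → isZero t ≡ true
isZeroWithCarry⇒isZero [] [] _ _ = refl
isZeroWithCarry⇒isZero (d₀ ∷ d) (false ∷ t) kernel refl
  rewrite isZeroWithCarry-∷ d₀ false false d t with ∧-≡true kernel
... | head-zero , tail-kernel = isZeroWithCarry⇒isZero d t tail-kernel (not-injective head-zero)

isZeroWithCarry⇒continuant : (d : Vec₂ n) (a : Bool) (t : Vec₂ n) →
  isZeroWithCarry d a t ≡ true → continuant d a (headOrFalse t) ≡ false
isZeroWithCarry⇒continuant [] a [] _ = refl
isZeroWithCarry⇒continuant (d₀ ∷ d) a (t₀ ∷ t) kernel
  rewrite isZeroWithCarry-∷ d₀ a t₀ d t with ∧-≡true kernel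
... | head-zero , tail-kernel =
  subst (λ y → continuant d t₀ y ≡ false) (not-xor-xor≡true⇒≡xor a (t₀ ∧ d₀) (headOrFalse t) head-zero)
    (isZeroWithCarry⇒continuant d t₀ t tail-kernel)

continuant⇒isZeroWithCarry : (d : Vec₂ n) (a y : Bool) → continuant d a y ≡ false →
  Σ[ t ∈ Vec₂ n ] headOrFalse t ≡ y × isZeroWithCarry d a t ≡ true
continuant⇒isZeroWithCarry [] a false _ = [] , refl , refl
continuant⇒isZeroWithCarry (d₀ ∷ d) a y end
  with continuant⇒isZeroWithCarry d y (a xor (y ∧ d₀)) end
... | t , head-t , kernel = y ∷ t , refl , solves
  where
  solves : isZeroWithCarry (d₀ ∷ d) a (y ∷ t) ≡ true
  solves rewrite isZeroWithCarry-∷ d₀ a y d t | head-t | kernel | not-xor-xor-cancel a (y ∧ d₀) = refl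

pathMatrix-independent : (d : Vec₂ n) → continuant d false true ≡ true →
  independentRows (pathMatrix d) (replicate n true) ≡ true
pathMatrix-independent d nonsingular = independentRows-intro (pathMatrix d) _ λ T _ zero-combo →
  let kernel = trans (sym (isZero-combo-pathMatrix d T)) zero-combo
  in isZeroWithCarry⇒isZero d T kernel (head-false T kernel)
  where
  head-false : ∀ T → isZeroWithCarry d false T ≡ true → headOrFalse T ≡ false
  head-false T kernel with headOrFalse T in head-T
  ... | false = refl
  ... | true with trans (sym nonsingular) (subst (λ y → continuant d false y ≡ false) head-T
                    (isZeroWithCarry⇒continuant d false T kernel))
  ...   | ()

pathMatrix-lowerRows-independent : (d : Vec₂ (suc n)) →
  independentRows (pathMatrix d) (false ∷ replicate n true) ≡ true
pathMatrix-lowerRows-independent d = independentRows-intro (pathMatrix d) _ λ where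
  (true ∷ T) () _
  (false ∷ T) _ zero-combo →
    isZeroWithCarry⇒isZero d (false ∷ T) (trans (sym (isZero-combo-pathMatrix d (false ∷ T))) zero-combo) refl

pathMatrix-dependent : (d : Vec₂ n) → continuant d false true ≡ false →
  independentRows (pathMatrix d) (replicate n true) ≡ false
pathMatrix-dependent d singular with continuant⇒isZeroWithCarry d false true singular
... | true ∷ t , refl , kernel =
  dependentRows (pathMatrix d) _ (true ∷ t) (⊆ᵇ-replicate-true (true ∷ t)) refl
    (trans (isZero-combo-pathMatrix d (true ∷ t)) kernel)

rank-pathMatrix-nonsingular : (d : Vec₂ n) → continuant d false true ≡ true → rank (pathMatrix d) ≡ n
rank-pathMatrix-nonsingular d nonsingular = rank-full (pathMatrix d) (pathMatrix-independent d nonsingular)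

rank-pathMatrix-singular : (d : Vec₂ (suc n)) → continuant d false true ≡ false → rank (pathMatrix d) ≡ n
rank-pathMatrix-singular d singular =
  rank-corank₁ (pathMatrix d) (pathMatrix-lowerRows-independent d) (pathMatrix-dependent d singular)

countContinuant : (p : Bool → Bool) (n : ℕ) (a y : Bool) → ℕ
countContinuant p n a y = countᵇ (λ d → p (continuant d a y)) (allVecs n)

R-path-full : (m : ℕ) → R-path (suc m) (suc m) ≡ countContinuant id (suc m) false true
R-path-full m = countᵇ-cong (allVecs (suc m)) full?
  where
  full? : (d : Vec₂ (suc m)) → (rank (pathMatrix d) ≡ᵇ suc m) ≡ continuant d false true
  full? d with continuant d false true in det
  ... | true rewrite rank-pathMatrix-nonsingular d det = dec-true (suc m ≟ suc m) refl
  ... | false rewrite rank-pathMatrix-singular d det = dec-false (m ≟ suc m) (≢-sym ℕ.1+n≢n)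

R-path-corank₁ : (m : ℕ) → R-path m (suc m) ≡ countContinuant not (suc m) false true
R-path-corank₁ m = countᵇ-cong (allVecs (suc m)) corank₁?
  where
  corank₁? : (d : Vec₂ (suc m)) → (rank (pathMatrix d) ≡ᵇ m) ≡ not (continuant d false true)
  corank₁? d with continuant d false true in det
  ... | true rewrite rank-pathMatrix-nonsingular d det = dec-false (suc m ≟ m) ℕ.1+n≢n
  ... | false rewrite rank-pathMatrix-singular d det = dec-true (m ≟ m) refl

countContinuant-suc : (p : Bool → Bool) (n : ℕ) (a y : Bool) →
  countContinuant p (suc n) a y ≡ countContinuant p n y (a xor (y ∧ false)) + countContinuant p n y (a xor (y ∧ true))
countContinuant-suc p n a y = countᵇ-allVecs-suc {n} (λ d → p (continuant d a y))

-- Splitting off d₁ and d₂: d₁ = 0 leaves the recurrence from (0, 1) on d₃ … for both values of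
-- d₂, while d₁ = 1 leaves it from (1, d₂), which is the recurrence from (0, 1) on d₂ d₃ ….
countContinuant-recurrence : (p : Bool → Bool) (n : ℕ) →
  countContinuant p (2 + n) false true ≡ countContinuant p (1 + n) false true + 2 * countContinuant p n false true
countContinuant-recurrence p n = begin
  c (2 + n) false true                                   ≡⟨ countContinuant-suc p (1 + n) false true ⟩
  c (1 + n) true false + c (1 + n) true true             ≡⟨ cong₂ _+_ (countContinuant-suc p n true false)
                                                                      (countContinuant-suc p n true true) ⟩
  (c n false true + c n false true) + (c n true true + c n true false)
                                                         ≡⟨ rearrange (c n false true) (c n true true) (c n true false) ⟩
  (c n true false + c n true true) + 2 * c n false true  ≡⟨ cong (_+ 2 * c n false true) (countContinuant-suc p n false true) ⟨
  c (1 + n) false true + 2 * c n false true              ∎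
  where
  open ≡-Reasoning
  c : ℕ → Bool → Bool → ℕ
  c = countContinuant p
  rearrange : ∀ x y z → (x + x) + (y + z) ≡ (z + y) + 2 * x
  rearrange = ℕ-Solver.solve-∀

module _ (f : ℕ → ℤ) (α β : ℤ) where

  JacobsthalForm : ℕ → Set
  JacobsthalForm n = + 3 *ℤ f n ≡ α *ℤ (+ 2) ^ℤ n +ℤ β *ℤ -1ℤ ^ℤ n

  jacobsthalForm : (∀ n → f (2 + n) ≡ f (1 + n) +ℤ + 2 *ℤ f n) →
    JacobsthalForm 0 → JacobsthalForm 1 → ∀ n → JacobsthalForm n
  jacobsthalForm recurrence h₀ h₁ n = proj₁ (consecutive n)
    where
    step : ∀ n → JacobsthalForm n → JacobsthalForm (1 + n) → JacobsthalForm (2 + n)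
    step n hₙ hₙ₊₁ = begin
      + 3 *ℤ f (2 + n)                                     ≡⟨ cong (+ 3 *ℤ_) (recurrence n) ⟩
      + 3 *ℤ (f (1 + n) +ℤ + 2 *ℤ f n)                     ≡⟨ distrib (f (1 + n)) (f n) ⟩
      + 3 *ℤ f (1 + n) +ℤ + 2 *ℤ (+ 3 *ℤ f n)              ≡⟨ cong₂ (λ u v → u +ℤ + 2 *ℤ v) hₙ₊₁ hₙ ⟩
      α *ℤ (+ 2 *ℤ P) +ℤ β *ℤ (-1ℤ *ℤ E) +ℤ + 2 *ℤ (α *ℤ P +ℤ β *ℤ E) ≡⟨ collect α β P E ⟩
      α *ℤ (+ 2 *ℤ (+ 2 *ℤ P)) +ℤ β *ℤ (-1ℤ *ℤ (-1ℤ *ℤ E)) ∎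
      where
      open ≡-Reasoning
      P = (+ 2) ^ℤ n
      E = -1ℤ ^ℤ n
      distrib : ∀ x y → + 3 *ℤ (x +ℤ + 2 *ℤ y) ≡ + 3 *ℤ x +ℤ + 2 *ℤ (+ 3 *ℤ y)
      distrib = solve-∀
      collect : ∀ a b p e → a *ℤ (+ 2 *ℤ p) +ℤ b *ℤ (-1ℤ *ℤ e) +ℤ + 2 *ℤ (a *ℤ p +ℤ b *ℤ e)
                            ≡ a *ℤ (+ 2 *ℤ (+ 2 *ℤ p)) +ℤ b *ℤ (-1ℤ *ℤ (-1ℤ *ℤ e))
      collect = solve-∀
    consecutive : ∀ n → JacobsthalForm n × JacobsthalForm (1 + n)
    consecutive zero = h₀ , h₁
    consecutive (suc n) with consecutive n
    ... | hₙ , hₙ₊₁ = hₙ₊₁ , step n hₙ hₙ₊₁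

pos-^ : ∀ m n → + (m ^ n) ≡ (+ m) ^ℤ n
pos-^ m zero = refl
pos-^ m (suc n) = trans (ℤ.pos-* m (m ^ n)) (cong (+ m *ℤ_) (pos-^ m n))

countContinuant-jacobsthalForm : (p : Bool → Bool) (α β : ℤ) →
  let f = λ n → + countContinuant p n false true in
  JacobsthalForm f α β 0 → JacobsthalForm f α β 1 → ∀ n → JacobsthalForm f α β n
countContinuant-jacobsthalForm p α β = jacobsthalForm (λ n → + c n) α β λ n → begin
  + c (2 + n)                 ≡⟨ cong +_ (countContinuant-recurrence p n) ⟩
  + (c (1 + n) + 2 * c n)     ≡⟨ ℤ.pos-+ (c (1 + n)) (2 * c n) ⟩
  + c (1 + n) +ℤ + (2 * c n)  ≡⟨ cong (+ c (1 + n) +ℤ_) (ℤ.pos-* 2 (c n)) ⟩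
  + c (1 + n) +ℤ + 2 *ℤ + c n ∎
  where
  open ≡-Reasoning
  c : ℕ → ℕ
  c n = countContinuant p n false true

count-nonsingular : ∀ n → + (3 * countContinuant id n false true) ≡ + (2 ^ suc n) +ℤ -1ℤ ^ℤ n
count-nonsingular n = begin
  + (3 * countContinuant id n false true)         ≡⟨ ℤ.pos-* 3 (countContinuant id n false true) ⟩
  + 3 *ℤ + countContinuant id n false true        ≡⟨ countContinuant-jacobsthalForm id (+ 2) (+ 1) refl refl n ⟩
  + 2 *ℤ (+ 2) ^ℤ n +ℤ + 1 *ℤ -1ℤ ^ℤ n            ≡⟨ cong₂ _+ℤ_ (sym (pos-^ 2 (suc n))) (ℤ.*-identityˡ (-1ℤ ^ℤ n)) ⟩
  + (2 ^ suc n) +ℤ -1ℤ ^ℤ n                       ∎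
  where open ≡-Reasoning

count-singular : ∀ n → + (3 * countContinuant not n false true) ≡ + (2 ^ n) +ℤ -1ℤ ^ℤ suc n
count-singular n = begin
  + (3 * countContinuant not n false true)        ≡⟨ ℤ.pos-* 3 (countContinuant not n false true) ⟩
  + 3 *ℤ + countContinuant not n false true       ≡⟨ countContinuant-jacobsthalForm not (+ 1) -1ℤ refl refl n ⟩
  + 1 *ℤ (+ 2) ^ℤ n +ℤ -1ℤ *ℤ -1ℤ ^ℤ n            ≡⟨ cong (_+ℤ -1ℤ ^ℤ suc n) (trans (ℤ.*-identityˡ _) (sym (pos-^ 2 n))) ⟩
  + (2 ^ n) +ℤ -1ℤ ^ℤ suc n                       ∎
  where open ≡-Reasoning

mainTheorem2 : (n : ℕ) → 1 ≤ n →
    (+ (3 * R-path n n) ≡ + (2 ^ (n + 1)) +ℤ (-1ℤ ^ℤ n))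
    × (+ (3 * R-path (n ∸ 1) n) ≡ + (2 ^ n) +ℤ (-1ℤ ^ℤ (n + 1)))
mainTheorem2 (suc m) _ rewrite R-path-full m | R-path-corank₁ m | ℕ.+-comm m 1 =
  count-nonsingular (suc m) , count-singular (suc m)
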